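{- Let $p$ be a prime, let $s\in\mathbb N$, and let $k,n_1,\ldots,n_s$ be nonnegative integers with $k\leq n_i$ for all $i$. Then $$\int_{\mathbb Z_p}B_{k,n_1}(x)B_{k,n_2}(x)\cdots B_{k,n_s}(x)\,d\mu_1(x)=\binom{n_1}{k}\binom{n_2}{k}\cdots\binom{n_s}{k}\sum_{l=0}^{n_1+\cdots+n_s-sk}\binom{n_1+\cdots+n_s-sk}{l}(-1)^{l}B_{sk+l}.$$
   Context: For integers $0\leq k\leq n$, the Bernstein polynomial is $B_{k,n}(x)=\binom{n}{k}x^k(1-x)^{n-k}$. $\mathbb Z_p$ denotes the ring of $p$-adic integers, and for a uniformly differentiable $f:\mathbb Z_p\to\mathbb C_p$ the bosonic $p$-adic (Volkenborn) integral is $\int_{\mathbb Z_p}f(x)\,d\mu_1(x)=\lim_{N\to\infty}\frac{1}{p^N}\sum_{x=0}^{p^N-1}f(x)$. $B_m$ denotes the $m$-th Bernoulli number, defined by $\frac{t}{e^t-1}=\sum_{m\geq0}B_m\frac{t^m}{m!}$; one has $\int_{\mathbb Z_p}x^m\,d\mu_1(x)=B_m$. -}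

module Defs where

open import Data.Nat as ℕ using (ℕ; zero; suc; NonZero)
open import Data.Nat.Properties using (m^n≢0)
open import Data.Nat.Divisibility using (_∣_)
open import Data.Nat.Primality using (Prime; prime⇒nonZero)
open import Data.Nat.Combinatorics using (_C_)
open import Data.Integer as ℤ using (ℤ; +_)
open import Data.Rational using (ℚ; 0ℚ; 1ℚ; _+_; _*_; _-_; -_; _/_)
open import Data.Fin using (Fin)
open import Data.Product using (∃-syntax; _×_)
open import Data.List using (List; []; _∷_; _++_; [_]; reverse)
open import Relation.Nullary using (¬_)
open import Relation.Binary.PropositionalEquality using (_≡_)

ℕ→ℚ : ℕ → ℚ
ℕ→ℚ n = (+ n) / 1

ℤ→ℚ : ℤ → ℚ
ℤ→ℚ a = a / 1

_^ℚ_ : ℚ → ℕ → ℚ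
x ^ℚ zero = 1ℚ
x ^ℚ suc n = x * (x ^ℚ n)

sumBelow : ℕ → (ℕ → ℚ) → ℚ
sumBelow zero f = 0ℚ
sumBelow (suc n) f = sumBelow n f + f n

prodFin : ∀ {s} → (Fin s → ℚ) → ℚ
prodFin {zero} f = 1ℚ
prodFin {suc s} f = f Data.Fin.zero * prodFin (λ i → f (Data.Fin.suc i))

sumFinℕ : ∀ {s} → (Fin s → ℕ) → ℕ
sumFinℕ {zero} f = 0
sumFinℕ {suc s} f = f Data.Fin.zero ℕ.+ sumFinℕ (λ i → f (Data.Fin.suc i))

bernstein : ℕ → ℕ → ℚ → ℚ
bernstein k n x = ℕ→ℚ (n C k) * (x ^ℚ k) * ((1ℚ - x) ^ℚ (n ℕ.∸ k))

-- Bernoulli numbers, from t/(e^t-1) = Σ B_m t^m/m!.  Comparing coefficients of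
-- t^(m+1) in t = (e^t - 1) Σ B_j t^j/j! gives B_0 = 1 and
-- Σ_{j=0}^{m} C(m+1,j) B_j = 0 for m ≥ 1, i.e.
-- B_{m+1} = -(1/(m+2)) Σ_{j=0}^{m} C(m+2,j) B_j.
-- bernRev m = [B_m, B_{m-1}, ..., B_0]
private
  weighted : ℕ → ℕ → List ℚ → ℚ
  weighted c j [] = 0ℚ
  weighted c j (b ∷ bs) = ℕ→ℚ (c C j) * b + weighted c (j ℕ.∸ 1) bs

bernRev : ℕ → List ℚ
bernRev zero = [ 1ℚ ]
bernRev (suc m) =
  (- (((+ 1) / (suc (suc m))) * weighted (suc (suc m)) m (bernRev m))) ∷ bernRev m

head0 : List ℚ → ℚ
head0 [] = 0ℚ
head0 (b ∷ _) = b

bernoulli : ℕ → ℚ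
bernoulli m = head0 (bernRev m)

-- p-adic closeness: q ∈ p^M ℤ_(p), i.e. q·b = p^M·a with a ∈ ℤ, b ∈ ℕ, p ∤ b
-- (equivalently q = 0 or v_p(q) ≥ M)
InPPow : ℕ → ℕ → ℚ → Set
InPPow p M q = ∃[ a ] ∃[ b ] (¬ (p ∣ b)) × (q * ℕ→ℚ b ≡ ℕ→ℚ (p ℕ.^ M) * ℤ→ℚ a)

ConvergesPAdic : ℕ → (ℕ → ℚ) → ℚ → Set
ConvergesPAdic p a L = ∀ M → ∃[ N₀ ] ∀ N → N₀ ℕ.≤ N → InPPow p M (a N - L)

riemannSum : (p : ℕ) → Prime p → (ℚ → ℚ) → ℕ → ℚ
riemannSum p pp f N =
  ((+ 1) / (p ℕ.^ N)) {{m^n≢0 p N {{prime⇒nonZero pp}}}} * sumBelow (p ℕ.^ N) (λ x → f (ℕ→ℚ x))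

-- ∫_{ℤ_p} f dμ₁ = L  (bosonic p-adic / Volkenborn integral), for f taking rational
-- values at the nonnegative integers (e.g. polynomials over ℚ)
VolkenbornIntegral≡ : (p : ℕ) → Prime p → (ℚ → ℚ) → ℚ → Set
VolkenbornIntegral≡ p pp f L = ConvergesPAdic p (riemannSum p pp f) L

{-# OPTIONS --safe #-}
-- Expanding the product, the integrand is (∏ C(nᵢ,k)) x^(sk) (1 - x)^(Σnᵢ - sk), and the binomial
-- theorem makes it a linear combination of the monomials x^(sk+l); since Riemann sums are linear,
-- it remains to show ∫ x^m dμ₁ = B_m.  For R_m(N) = p^(-N) Σ_{x<p^N} x^m, telescoping
-- (x+1)^(m+1) - x^(m+1) gives Σ_{j≤m} C(m+1,j) R_j(N) = p^(Nm), which tends p-adically to [m = 0].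
-- The Bernoulli numbers solve the same triangular system with right-hand side [m = 0], and its
-- diagonal entries m + 1 are invertible, so R_m(N) → B_m by strong induction on m.
module Submission where

open import Defs
open import Data.Nat using (ℕ; zero; suc; _≤_; _<_; _+_; _*_; _∸_; _^_; _⊔_; z≤n; NonZero)
import Data.Nat.Properties as ℕP
open import Data.Nat.Induction using (<-rec)
open import Data.Nat.Divisibility
  using (_∣_; divides; _∣?_; _∣0; ∣1⇒≡1; ∣-trans; m∣m*n; quotient-<; quotient≢0)
open import Data.Nat.Primality
  using (Prime; euclidsLemma; ¬prime[1]; prime⇒nonZero; prime⇒nonTrivial)
open import Data.Nat.Combinatorics
  using (_C_; nCk+nC[k+1]≡[n+1]C[k+1]; nCn≡1; nC1≡n; nCk≡nC[n∸k]; k>n⇒nCk≡0)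
open import Data.Integer as ℤ using (+_)
import Data.Integer.Properties as ℤP
open import Data.Rational using (ℚ; 0ℚ; 1ℚ; ↥_; ↧ₙ_; toℚᵘ; _/_)
  renaming (_+_ to _+ℚ_; _-_ to _-ℚ_; _*_ to _*ℚ_; -_ to -ℚ_)
import Data.Rational.Properties as ℚP
open import Data.Rational.Unnormalised as ℚᵘ using (mkℚᵘ; *≡*)
import Data.Rational.Unnormalised.Properties as ℚᵘP
open import Data.Rational.Solver using (module +-*-Solver)
open import Data.Fin as Fin using (Fin)
open import Data.Product using (_,_; _×_; ∃-syntax; proj₁; map₂)
open import Data.Sum using ([_,_])
open import Function using (_∘_)
open import Relation.Nullary using (¬_; yes; no)
open import Relation.Binary.PropositionalEquality hiding ([_])
open +-*-Solver
open ≡-Reasoning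

toℚᵘ-ℤ→ℚ : ∀ i → toℚᵘ (ℤ→ℚ i) ℚᵘ.≃ mkℚᵘ i 0
toℚᵘ-ℤ→ℚ i = ℚP.toℚᵘ-fromℚᵘ (mkℚᵘ i 0)

ℤ→ℚ-homo-+ : ∀ i j → ℤ→ℚ (i ℤ.+ j) ≡ ℤ→ℚ i +ℚ ℤ→ℚ j
ℤ→ℚ-homo-+ i j = ℚP.toℚᵘ-injective (begin-≃
    toℚᵘ (ℤ→ℚ (i ℤ.+ j))            ≈⟨ toℚᵘ-ℤ→ℚ (i ℤ.+ j) ⟩
    mkℚᵘ (i ℤ.+ j) 0                 ≈⟨ *≡* (cong₂ (λ u v → (u ℤ.+ v) ℤ.* + 1)
                                          (sym (ℤP.*-identityʳ i)) (sym (ℤP.*-identityʳ j))) ⟩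
    mkℚᵘ i 0 ℚᵘ.+ mkℚᵘ j 0           ≈⟨ ℚᵘP.+-cong (toℚᵘ-ℤ→ℚ i) (toℚᵘ-ℤ→ℚ j) ⟨
    toℚᵘ (ℤ→ℚ i) ℚᵘ.+ toℚᵘ (ℤ→ℚ j)   ≈⟨ ℚP.toℚᵘ-homo-+ (ℤ→ℚ i) (ℤ→ℚ j) ⟨
    toℚᵘ (ℤ→ℚ i +ℚ ℤ→ℚ j)            ∎≃)
  where open ℚᵘP.≃-Reasoning renaming (begin_ to begin-≃_; _∎ to _∎≃)

ℤ→ℚ-homo-* : ∀ i j → ℤ→ℚ (i ℤ.* j) ≡ ℤ→ℚ i *ℚ ℤ→ℚ j
ℤ→ℚ-homo-* i j = ℚP.toℚᵘ-injective (ℚᵘP.≃-trans (toℚᵘ-ℤ→ℚ (i ℤ.* j))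
  (ℚᵘP.≃-sym (ℚᵘP.≃-trans (ℚP.toℚᵘ-homo-* (ℤ→ℚ i) (ℤ→ℚ j)) (ℚᵘP.*-cong (toℚᵘ-ℤ→ℚ i) (toℚᵘ-ℤ→ℚ j)))))

ℤ→ℚ-homo‿- : ∀ i → ℤ→ℚ (ℤ.- i) ≡ -ℚ ℤ→ℚ i
ℤ→ℚ-homo‿- i = ℚP.toℚᵘ-injective (ℚᵘP.≃-trans (toℚᵘ-ℤ→ℚ (ℤ.- i))
  (ℚᵘP.≃-sym (ℚᵘP.≃-trans (ℚP.toℚᵘ-homo‿- (ℤ→ℚ i)) (ℚᵘP.-‿cong (toℚᵘ-ℤ→ℚ i)))))

ℕ→ℚ-homo-+ : ∀ m n → ℕ→ℚ (m + n) ≡ ℕ→ℚ m +ℚ ℕ→ℚ n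
ℕ→ℚ-homo-+ m n = ℤ→ℚ-homo-+ (+ m) (+ n)

ℕ→ℚ-homo-* : ∀ m n → ℕ→ℚ (m * n) ≡ ℕ→ℚ m *ℚ ℕ→ℚ n
ℕ→ℚ-homo-* m n = trans (cong ℤ→ℚ (ℤP.pos-* m n)) (ℤ→ℚ-homo-* (+ m) (+ n))

i/n*n≡i : ∀ i n .{{_ : NonZero n}} → (i / n) *ℚ ℕ→ℚ n ≡ ℤ→ℚ i
i/n*n≡i i (suc d) = ℚP.toℚᵘ-injective (ℚᵘP.≃-trans (ℚP.toℚᵘ-homo-* (i / suc d) (ℕ→ℚ (suc d)))
  (ℚᵘP.≃-trans (ℚᵘP.*-cong (ℚP.toℚᵘ-fromℚᵘ (mkℚᵘ i d)) (toℚᵘ-ℤ→ℚ (+ suc d)))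
  (ℚᵘP.≃-trans (*≡* i*[1+d]*1≡i*[1+d*1]) (ℚᵘP.≃-sym (toℚᵘ-ℤ→ℚ i)))))
  where
  i*[1+d]*1≡i*[1+d*1] : (i ℤ.* + suc d) ℤ.* + 1 ≡ i ℤ.* + suc (d * 1)
  i*[1+d]*1≡i*[1+d*1] = trans (ℤP.*-identityʳ _) (cong (λ e → i ℤ.* + suc e) (sym (ℕP.*-identityʳ d)))

1/n*n≡1 : ∀ n .{{_ : NonZero n}} → ((+ 1) / n) *ℚ ℕ→ℚ n ≡ 1ℚ
1/n*n≡1 n = i/n*n≡i (+ 1) n

q*↧q≡↥q : ∀ q → q *ℚ ℕ→ℚ (↧ₙ q) ≡ ℤ→ℚ (↥ q)
q*↧q≡↥q q = trans (cong (_*ℚ ℕ→ℚ (↧ₙ q)) (sym (ℚP.↥p/↧p≡p q))) (i/n*n≡i (↥ q) (↧ₙ q))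

sumBelow-cong : ∀ n {f g : ℕ → ℚ} → (∀ i → f i ≡ g i) → sumBelow n f ≡ sumBelow n g
sumBelow-cong zero    f≗g = refl
sumBelow-cong (suc n) f≗g = cong₂ _+ℚ_ (sumBelow-cong n f≗g) (f≗g n)

sumBelow-0 : ∀ n → sumBelow n (λ _ → 0ℚ) ≡ 0ℚ
sumBelow-0 zero    = refl
sumBelow-0 (suc n) = trans (ℚP.+-identityʳ _) (sumBelow-0 n)

sumBelow-+ : ∀ n (f g : ℕ → ℚ) → sumBelow n (λ i → f i +ℚ g i) ≡ sumBelow n f +ℚ sumBelow n g
sumBelow-+ zero    f g = refl
sumBelow-+ (suc n) f g = trans (cong (_+ℚ (f n +ℚ g n)) (sumBelow-+ n f g))
  (solve 4 (λ a b c d → (a :+ b) :+ (c :+ d) := (a :+ c) :+ (b :+ d)) refl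
    (sumBelow n f) (sumBelow n g) (f n) (g n))

*-distribˡ-sumBelow : ∀ n c (f : ℕ → ℚ) → c *ℚ sumBelow n f ≡ sumBelow n (λ i → c *ℚ f i)
*-distribˡ-sumBelow zero    c f = ℚP.*-zeroʳ c
*-distribˡ-sumBelow (suc n) c f = trans (ℚP.*-distribˡ-+ c (sumBelow n f) (f n))
  (cong (_+ℚ c *ℚ f n) (*-distribˡ-sumBelow n c f))

sumBelow-comm : ∀ m n (f : ℕ → ℕ → ℚ) →
  sumBelow m (λ i → sumBelow n (f i)) ≡ sumBelow n (λ j → sumBelow m (λ i → f i j))
sumBelow-comm zero    n f = sym (sumBelow-0 n)
sumBelow-comm (suc m) n f = trans (cong (_+ℚ sumBelow n (f m)) (sumBelow-comm m n f))
  (sym (sumBelow-+ n (λ j → sumBelow m (λ i → f i j)) (f m)))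

sumBelow-head : ∀ n (f : ℕ → ℚ) → sumBelow (suc n) f ≡ f 0 +ℚ sumBelow n (λ i → f (suc i))
sumBelow-head zero    f = trans (ℚP.+-identityˡ (f 0)) (sym (ℚP.+-identityʳ (f 0)))
sumBelow-head (suc n) f = trans (cong (_+ℚ f (suc n)) (sumBelow-head n f))
  (ℚP.+-assoc (f 0) (sumBelow n (λ i → f (suc i))) (f (suc n)))

sumBelow-telescope : ∀ n (g : ℕ → ℚ) → sumBelow n (λ i → g (suc i) -ℚ g i) ≡ g n -ℚ g 0
sumBelow-telescope zero    g = sym (ℚP.+-inverseʳ (g 0))
sumBelow-telescope (suc n) g = trans (cong (_+ℚ (g (suc n) -ℚ g n)) (sumBelow-telescope n g))
  (solve 3 (λ a b c → (b :- a) :+ (c :- b) := c :- a) refl (g 0) (g n) (g (suc n)))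

^ℚ-distribˡ-+-* : ∀ x a b → x ^ℚ (a + b) ≡ x ^ℚ a *ℚ x ^ℚ b
^ℚ-distribˡ-+-* x zero    b = sym (ℚP.*-identityˡ (x ^ℚ b))
^ℚ-distribˡ-+-* x (suc a) b = trans (cong (x *ℚ_) (^ℚ-distribˡ-+-* x a b))
  (sym (ℚP.*-assoc x (x ^ℚ a) (x ^ℚ b)))

^ℚ-distribʳ-* : ∀ x y n → (x *ℚ y) ^ℚ n ≡ x ^ℚ n *ℚ y ^ℚ n
^ℚ-distribʳ-* x y zero    = refl
^ℚ-distribʳ-* x y (suc n) = trans (cong ((x *ℚ y) *ℚ_) (^ℚ-distribʳ-* x y n))
  (solve 4 (λ x y u v → (x :* y) :* (u :* v) := (x :* u) :* (y :* v)) refl x y (x ^ℚ n) (y ^ℚ n))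

ℕ→ℚ-homo-^ : ∀ a n → ℕ→ℚ (a ^ n) ≡ ℕ→ℚ a ^ℚ n
ℕ→ℚ-homo-^ a zero    = refl
ℕ→ℚ-homo-^ a (suc n) = trans (ℕ→ℚ-homo-* a (a ^ n)) (cong (ℕ→ℚ a *ℚ_) (ℕ→ℚ-homo-^ a n))

binomial-theorem : ∀ m y → (1ℚ +ℚ y) ^ℚ m ≡ sumBelow (suc m) (λ j → ℕ→ℚ (m C j) *ℚ y ^ℚ j)
binomial-theorem zero    y = refl
binomial-theorem (suc m) y = sym (begin
    sumBelow (suc (suc m)) F
  ≡⟨ sumBelow-head (suc m) F ⟩
    1ℚ +ℚ sumBelow (suc m) (λ j → F (suc j))
  ≡⟨ cong (1ℚ +ℚ_) (sumBelow-cong (suc m) pascal) ⟩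
    1ℚ +ℚ sumBelow (suc m) (λ j → y *ℚ G j +ℚ G (suc j))
  ≡⟨ cong (1ℚ +ℚ_) (sumBelow-+ (suc m) (λ j → y *ℚ G j) (λ j → G (suc j))) ⟩
    1ℚ +ℚ (sumBelow (suc m) (λ j → y *ℚ G j) +ℚ S)
  ≡⟨ cong (λ u → 1ℚ +ℚ (u +ℚ S)) (sym (*-distribˡ-sumBelow (suc m) y G)) ⟩
    1ℚ +ℚ (y *ℚ T +ℚ S)
  ≡⟨ cong (λ t → 1ℚ +ℚ (y *ℚ t +ℚ S)) (sym 1+S≡T) ⟩
    1ℚ +ℚ (y *ℚ (1ℚ +ℚ S) +ℚ S)
  ≡⟨ solve 2 (λ y s → con 1ℚ :+ (y :* (con 1ℚ :+ s) :+ s) := (con 1ℚ :+ y) :* (con 1ℚ :+ s)) refl y S ⟩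
    (1ℚ +ℚ y) *ℚ (1ℚ +ℚ S)
  ≡⟨ cong ((1ℚ +ℚ y) *ℚ_) (trans 1+S≡T (sym (binomial-theorem m y))) ⟩
    (1ℚ +ℚ y) ^ℚ suc m
  ∎)
  where
  F G : ℕ → ℚ
  F j = ℕ→ℚ (suc m C j) *ℚ y ^ℚ j
  G j = ℕ→ℚ (m C j) *ℚ y ^ℚ j
  T S : ℚ
  T = sumBelow (suc m) G
  S = sumBelow (suc m) (λ j → G (suc j))
  pascal : ∀ j → F (suc j) ≡ y *ℚ G j +ℚ G (suc j)
  pascal j = begin
      ℕ→ℚ (suc m C suc j) *ℚ y ^ℚ suc j
    ≡⟨ cong (λ c → ℕ→ℚ c *ℚ y ^ℚ suc j) (sym (nCk+nC[k+1]≡[n+1]C[k+1] m j)) ⟩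
      ℕ→ℚ (m C j + m C suc j) *ℚ y ^ℚ suc j
    ≡⟨ cong (_*ℚ y ^ℚ suc j) (ℕ→ℚ-homo-+ (m C j) (m C suc j)) ⟩
      (ℕ→ℚ (m C j) +ℚ ℕ→ℚ (m C suc j)) *ℚ (y *ℚ y ^ℚ j)
    ≡⟨ solve 4 (λ a b y u → (a :+ b) :* (y :* u) := y :* (a :* u) :+ b :* (y :* u)) refl
         (ℕ→ℚ (m C j)) (ℕ→ℚ (m C suc j)) y (y ^ℚ j) ⟩
      y *ℚ G j +ℚ G (suc j)
    ∎
  1+S≡T : 1ℚ +ℚ S ≡ T
  1+S≡T = begin
      1ℚ +ℚ S
    ≡⟨ sumBelow-head (suc m) G ⟨
      T +ℚ ℕ→ℚ (m C suc m) *ℚ y ^ℚ suc m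
    ≡⟨ cong (λ c → T +ℚ ℕ→ℚ c *ℚ y ^ℚ suc m) (k>n⇒nCk≡0 (ℕP.n<1+n m)) ⟩
      T +ℚ 0ℚ *ℚ y ^ℚ suc m
    ≡⟨ solve 2 (λ t u → t :+ con 0ℚ :* u := t) refl T (y ^ℚ suc m) ⟩
      T
    ∎

[1+m]Cm≡1+m : ∀ m → suc m C m ≡ suc m
[1+m]Cm≡1+m m = trans (nCk≡nC[n∸k] (ℕP.n≤1+n m))
  (trans (cong (suc m C_) (ℕP.m+n∸n≡m 1 m)) (nC1≡n (suc m)))

binomialSum : (ℕ → ℚ) → ℕ → ℚ
binomialSum b m = sumBelow (suc m) (λ j → ℕ→ℚ (suc m C j) *ℚ b j)

binomialSum-top : ∀ b m →
  b m ≡ ((+ 1) / suc m) *ℚ (binomialSum b m -ℚ sumBelow m (λ j → ℕ→ℚ (suc m C j) *ℚ b j))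
binomialSum-top b m = sym (begin
    i *ℚ ((S +ℚ ℕ→ℚ (suc m C m) *ℚ b m) -ℚ S)
  ≡⟨ cong (λ c → i *ℚ ((S +ℚ ℕ→ℚ c *ℚ b m) -ℚ S)) ([1+m]Cm≡1+m m) ⟩
    i *ℚ ((S +ℚ ℕ→ℚ (suc m) *ℚ b m) -ℚ S)
  ≡⟨ solve 4 (λ i s n b → i :* ((s :+ n :* b) :- s) := (i :* n) :* b) refl i S (ℕ→ℚ (suc m)) (b m) ⟩
    (i *ℚ ℕ→ℚ (suc m)) *ℚ b m
  ≡⟨ cong (_*ℚ b m) (1/n*n≡1 (suc m)) ⟩
    1ℚ *ℚ b m
  ≡⟨ ℚP.*-identityˡ (b m) ⟩
    b m
  ∎)
  where
  i = (+ 1) / suc m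
  S = sumBelow m (λ j → ℕ→ℚ (suc m C j) *ℚ b j)

binomialSum-*ˡ : ∀ c b m → binomialSum (λ j → c *ℚ b j) m ≡ c *ℚ binomialSum b m
binomialSum-*ˡ c b m = trans
  (sumBelow-cong (suc m) (λ j →
    solve 3 (λ a c b → a :* (c :* b) := c :* (a :* b)) refl (ℕ→ℚ (suc m C j)) c (b j)))
  (sym (*-distribˡ-sumBelow (suc m) c (λ j → ℕ→ℚ (suc m C j) *ℚ b j)))

binomialSum-sumBelow : ∀ n (f : ℕ → ℕ → ℚ) m →
  binomialSum (λ j → sumBelow n (λ x → f x j)) m ≡ sumBelow n (λ x → binomialSum (f x) m)
binomialSum-sumBelow n f m = trans
  (sumBelow-cong (suc m) (λ j → *-distribˡ-sumBelow n (ℕ→ℚ (suc m C j)) (λ x → f x j)))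
  (sumBelow-comm (suc m) n (λ j x → ℕ→ℚ (suc m C j) *ℚ f x j))

binomialSum-^ : ∀ X m → binomialSum (X ^ℚ_) m ≡ (1ℚ +ℚ X) ^ℚ suc m -ℚ X ^ℚ suc m
binomialSum-^ X m = sym (begin
    (1ℚ +ℚ X) ^ℚ suc m -ℚ X ^ℚ suc m
  ≡⟨ cong (_-ℚ X ^ℚ suc m) (binomial-theorem (suc m) X) ⟩
    (binomialSum (X ^ℚ_) m +ℚ ℕ→ℚ (suc m C suc m) *ℚ X ^ℚ suc m) -ℚ X ^ℚ suc m
  ≡⟨ cong (λ c → (binomialSum (X ^ℚ_) m +ℚ ℕ→ℚ c *ℚ X ^ℚ suc m) -ℚ X ^ℚ suc m) (nCn≡1 (suc m)) ⟩
    (binomialSum (X ^ℚ_) m +ℚ 1ℚ *ℚ X ^ℚ suc m) -ℚ X ^ℚ suc m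
  ≡⟨ solve 2 (λ t u → (t :+ con 1ℚ :* u) :- u := t) refl (binomialSum (X ^ℚ_) m) (X ^ℚ suc m) ⟩
    binomialSum (X ^ℚ_) m
  ∎)

binomialSum-powerSum : ∀ n m → binomialSum (λ j → sumBelow n (λ x → ℕ→ℚ x ^ℚ j)) m ≡ ℕ→ℚ n ^ℚ suc m
binomialSum-powerSum n m = begin
    binomialSum (λ j → sumBelow n (λ x → ℕ→ℚ x ^ℚ j)) m
  ≡⟨ binomialSum-sumBelow n (λ x j → ℕ→ℚ x ^ℚ j) m ⟩
    sumBelow n (λ x → binomialSum (ℕ→ℚ x ^ℚ_) m)
  ≡⟨ sumBelow-cong n (λ x → trans (binomialSum-^ (ℕ→ℚ x) m)
       (cong (λ y → y ^ℚ suc m -ℚ ℕ→ℚ x ^ℚ suc m) (sym (ℕ→ℚ-homo-+ 1 x)))) ⟩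
    sumBelow n (λ x → ℕ→ℚ (suc x) ^ℚ suc m -ℚ ℕ→ℚ x ^ℚ suc m)
  ≡⟨ sumBelow-telescope n (λ x → ℕ→ℚ x ^ℚ suc m) ⟩
    ℕ→ℚ n ^ℚ suc m -ℚ 0ℚ *ℚ 0ℚ ^ℚ m
  ≡⟨ solve 2 (λ a b → a :- con 0ℚ :* b := a) refl (ℕ→ℚ n ^ℚ suc m) (0ℚ ^ℚ m) ⟩
    ℕ→ℚ n ^ℚ suc m
  ∎

binomialSum-meanPowerSum : ∀ n .{{_ : NonZero n}} m →
  binomialSum (λ j → ((+ 1) / n) *ℚ sumBelow n (λ x → ℕ→ℚ x ^ℚ j)) m ≡ ℕ→ℚ n ^ℚ m
binomialSum-meanPowerSum n m = begin
    binomialSum (λ j → i *ℚ sumBelow n (λ x → ℕ→ℚ x ^ℚ j)) m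
  ≡⟨ binomialSum-*ˡ i (λ j → sumBelow n (λ x → ℕ→ℚ x ^ℚ j)) m ⟩
    i *ℚ binomialSum (λ j → sumBelow n (λ x → ℕ→ℚ x ^ℚ j)) m
  ≡⟨ cong (i *ℚ_) (binomialSum-powerSum n m) ⟩
    i *ℚ (ℕ→ℚ n *ℚ ℕ→ℚ n ^ℚ m)
  ≡⟨ ℚP.*-assoc i (ℕ→ℚ n) (ℕ→ℚ n ^ℚ m) ⟨
    (i *ℚ ℕ→ℚ n) *ℚ ℕ→ℚ n ^ℚ m
  ≡⟨ cong (_*ℚ ℕ→ℚ n ^ℚ m) (1/n*n≡1 n) ⟩
    1ℚ *ℚ ℕ→ℚ n ^ℚ m
  ≡⟨ ℚP.*-identityˡ (ℕ→ℚ n ^ℚ m) ⟩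
    ℕ→ℚ n ^ℚ m
  ∎
  where i = (+ 1) / n

-- The weighted sum in the recursion defining bernRev is private.  Unification recovers it as
-- weightedSum w j (its value at suc w, j and bernRev j), whose defining equations then hold by refl.
private
  bernoulli-suc-shape : ∀ m → ∃[ q ] bernoulli (suc m) ≡ -ℚ (((+ 1) / suc (suc m)) *ℚ q)
  bernoulli-suc-shape m = _ , refl

  mutual
    weightedSum : ℕ → ℕ → ℚ
    weightedSum = _

    weightedSum-shape : ∀ m → proj₁ (bernoulli-suc-shape m) ≡ weightedSum (suc m) m
    weightedSum-shape m with suc m
    ... | _ = refl

  weightedSum≡sumBelow : ∀ w j → weightedSum w j ≡ sumBelow (suc j) (λ i → ℕ→ℚ (suc w C i) *ℚ bernoulli i)
  weightedSum≡sumBelow w zero    = refl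
  weightedSum≡sumBelow w (suc j) = trans (cong (t +ℚ_) (weightedSum≡sumBelow w j)) (ℚP.+-comm t _)
    where t = ℕ→ℚ (suc w C suc j) *ℚ bernoulli (suc j)

bernoulli-suc : ∀ m →
  bernoulli (suc m) ≡
  -ℚ (((+ 1) / suc (suc m)) *ℚ sumBelow (suc m) (λ i → ℕ→ℚ (suc (suc m) C i) *ℚ bernoulli i))
bernoulli-suc m = cong (λ q → -ℚ (((+ 1) / suc (suc m)) *ℚ q))
  (trans (weightedSum-shape m) (weightedSum≡sumBelow (suc m) m))

δ₀ : ℕ → ℚ
δ₀ zero    = 1ℚ
δ₀ (suc _) = 0ℚ

binomialSum-bernoulli : ∀ m → binomialSum bernoulli m ≡ δ₀ m
binomialSum-bernoulli zero    = refl
binomialSum-bernoulli (suc m) = begin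
    W +ℚ ℕ→ℚ (suc (suc m) C suc m) *ℚ bernoulli (suc m)
  ≡⟨ cong₂ (λ c b → W +ℚ ℕ→ℚ c *ℚ b) ([1+m]Cm≡1+m (suc m)) (bernoulli-suc m) ⟩
    W +ℚ ℕ→ℚ (suc (suc m)) *ℚ (-ℚ (i *ℚ W))
  ≡⟨ solve 3 (λ w n i → w :+ n :* (:- (i :* w)) := w :* (con 1ℚ :- i :* n)) refl W (ℕ→ℚ (suc (suc m))) i ⟩
    W *ℚ (1ℚ -ℚ i *ℚ ℕ→ℚ (suc (suc m)))
  ≡⟨ cong (λ u → W *ℚ (1ℚ -ℚ u)) (1/n*n≡1 (suc (suc m))) ⟩
    W *ℚ (1ℚ -ℚ 1ℚ)
  ≡⟨ solve 1 (λ w → w :* (con 1ℚ :- con 1ℚ) := con 0ℚ) refl W ⟩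
    0ℚ
  ∎
  where
  W = sumBelow (suc m) (λ j → ℕ→ℚ (suc (suc m) C j) *ℚ bernoulli j)
  i = (+ 1) / suc (suc m)

m^n∣m^o : ∀ m {n o} → n ≤ o → m ^ n ∣ m ^ o
m^n∣m^o m {n} {o} n≤o = divides (m ^ (o ∸ n)) (begin
    m ^ o                    ≡⟨ cong (m ^_) (ℕP.m+[n∸m]≡n n≤o) ⟨
    m ^ (n + (o ∸ n))        ≡⟨ ℕP.^-distribˡ-+-* m n (o ∸ n) ⟩
    m ^ n * m ^ (o ∸ n)      ≡⟨ ℕP.*-comm (m ^ n) (m ^ (o ∸ n)) ⟩
    m ^ (o ∸ n) * m ^ n      ∎)

module _ (p : ℕ) (pp : Prime p) where

  private
    instance
      p-nonZero : NonZero p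
      p-nonZero = prime⇒nonZero pp

  p∤1 : ¬ (p ∣ 1)
  p∤1 p∣1 = ¬prime[1] (subst Prime (∣1⇒≡1 p∣1) pp)

  p∤* : ∀ {m n} → ¬ (p ∣ m) → ¬ (p ∣ n) → ¬ (p ∣ m * n)
  p∤* {m} {n} p∤m p∤n p∣mn = [ p∤m , p∤n ] (euclidsLemma m n pp p∣mn)

  PAdicSplit : ℕ → Set
  PAdicSplit n = ∃[ r ] ∃[ d ] (n ≡ p ^ r * d) × ¬ (p ∣ d)

  pAdicSplit : ∀ n .{{_ : NonZero n}} → PAdicSplit n
  pAdicSplit = <-rec (λ n → .{{NonZero n}} → PAdicSplit n) split
    where
    split : ∀ n → (∀ {m} → m < n → .{{NonZero m}} → PAdicSplit m) → .{{NonZero n}} → PAdicSplit n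
    split n rec with p ∣? n
    ... | no p∤n = 0 , n , sym (ℕP.*-identityˡ n) , p∤n
    ... | yes p∣n@(divides q n≡q*p) with rec (quotient-< p∣n {{prime⇒nonTrivial pp}}) {{quotient≢0 p∣n}}
    ...   | r , d , q≡p^r*d , p∤d = suc r , d , (begin
      n                  ≡⟨ n≡q*p ⟩
      q * p              ≡⟨ cong (_* p) q≡p^r*d ⟩
      p ^ r * d * p      ≡⟨ ℕP.*-comm (p ^ r * d) p ⟩
      p * (p ^ r * d)    ≡⟨ ℕP.*-assoc p (p ^ r) d ⟨
      p ^ suc r * d      ∎) , p∤d

  ∣⇒InPPow : ∀ {M n} → p ^ M ∣ n → InPPow p M (ℕ→ℚ n)
  ∣⇒InPPow {M} {n} (divides q n≡q*p^M) = + q , 1 , p∤1 , (begin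
      ℕ→ℚ n *ℚ 1ℚ                 ≡⟨ ℚP.*-identityʳ (ℕ→ℚ n) ⟩
      ℕ→ℚ n                       ≡⟨ cong ℕ→ℚ (trans n≡q*p^M (ℕP.*-comm q (p ^ M))) ⟩
      ℕ→ℚ (p ^ M * q)             ≡⟨ ℕ→ℚ-homo-* (p ^ M) q ⟩
      ℕ→ℚ (p ^ M) *ℚ ℤ→ℚ (+ q)   ∎)

  InPPow-0 : ∀ M → InPPow p M 0ℚ
  InPPow-0 M = ∣⇒InPPow {M} ((p ^ M) ∣0)

  InPPow-+ : ∀ {M x y} → InPPow p M x → InPPow p M y → InPPow p M (x +ℚ y)
  InPPow-+ {M} {x} {y} (a₁ , b₁ , p∤b₁ , eq₁) (a₂ , b₂ , p∤b₂ , eq₂) =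
    a₁ ℤ.* + b₂ ℤ.+ a₂ ℤ.* + b₁ , b₁ * b₂ , p∤* p∤b₁ p∤b₂ , (begin
      (x +ℚ y) *ℚ ℕ→ℚ (b₁ * b₂)
    ≡⟨ cong ((x +ℚ y) *ℚ_) (ℕ→ℚ-homo-* b₁ b₂) ⟩
      (x +ℚ y) *ℚ (B₁ *ℚ B₂)
    ≡⟨ solve 4 (λ x y u v → (x :+ y) :* (u :* v) := (x :* u) :* v :+ (y :* v) :* u) refl x y B₁ B₂ ⟩
      (x *ℚ B₁) *ℚ B₂ +ℚ (y *ℚ B₂) *ℚ B₁
    ≡⟨ cong₂ (λ s t → s *ℚ B₂ +ℚ t *ℚ B₁) eq₁ eq₂ ⟩
      (P *ℚ A₁) *ℚ B₂ +ℚ (P *ℚ A₂) *ℚ B₁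
    ≡⟨ solve 5 (λ q a c u v → (q :* a) :* v :+ (q :* c) :* u := q :* (a :* v :+ c :* u)) refl P A₁ A₂ B₁ B₂ ⟩
      P *ℚ (A₁ *ℚ B₂ +ℚ A₂ *ℚ B₁)
    ≡⟨ cong (P *ℚ_) (cong₂ _+ℚ_ (ℤ→ℚ-homo-* a₁ (+ b₂)) (ℤ→ℚ-homo-* a₂ (+ b₁))) ⟨
      P *ℚ (ℤ→ℚ (a₁ ℤ.* + b₂) +ℚ ℤ→ℚ (a₂ ℤ.* + b₁))
    ≡⟨ cong (P *ℚ_) (ℤ→ℚ-homo-+ (a₁ ℤ.* + b₂) (a₂ ℤ.* + b₁)) ⟨
      P *ℚ ℤ→ℚ (a₁ ℤ.* + b₂ ℤ.+ a₂ ℤ.* + b₁)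
    ∎)
    where
    P = ℕ→ℚ (p ^ M)
    A₁ = ℤ→ℚ a₁
    A₂ = ℤ→ℚ a₂
    B₁ = ℕ→ℚ b₁
    B₂ = ℕ→ℚ b₂

  InPPow-neg : ∀ {M x} → InPPow p M x → InPPow p M (-ℚ x)
  InPPow-neg {M} {x} (a , b , p∤b , eq) = ℤ.- a , b , p∤b , (begin
      (-ℚ x) *ℚ ℕ→ℚ b          ≡⟨ ℚP.neg-distribˡ-* x (ℕ→ℚ b) ⟨
      -ℚ (x *ℚ ℕ→ℚ b)          ≡⟨ cong -ℚ_ eq ⟩
      -ℚ (P *ℚ ℤ→ℚ a)          ≡⟨ ℚP.neg-distribʳ-* P (ℤ→ℚ a) ⟩
      P *ℚ (-ℚ ℤ→ℚ a)          ≡⟨ cong (P *ℚ_) (ℤ→ℚ-homo‿- a) ⟨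
      P *ℚ ℤ→ℚ (ℤ.- a)        ∎)
    where P = ℕ→ℚ (p ^ M)

  -- Writing the denominator of c as p ^ r * d with p ∤ d, multiplication by c costs r powers of p.
  InPPow-*ˡ : ∀ c → ∃[ r ] ∀ M {x} → InPPow p (M + r) x → InPPow p M (c *ℚ x)
  InPPow-*ˡ c with pAdicSplit (↧ₙ c)
  ... | r , d , ↧c≡p^r*d , p∤d = r , scale
    where
    scale : ∀ M {x} → InPPow p (M + r) x → InPPow p M (c *ℚ x)
    scale M {x} (a , b , p∤b , eq) = ↥ c ℤ.* a , b * d , p∤* p∤b p∤d , (begin
        (c *ℚ x) *ℚ ℕ→ℚ (b * d)
      ≡⟨ cong ((c *ℚ x) *ℚ_) (ℕ→ℚ-homo-* b d) ⟩
        (c *ℚ x) *ℚ (ℕ→ℚ b *ℚ D)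
      ≡⟨ solve 4 (λ c x b d → (c :* x) :* (b :* d) := c :* d :* (x :* b)) refl c x (ℕ→ℚ b) D ⟩
        c *ℚ D *ℚ (x *ℚ ℕ→ℚ b)
      ≡⟨ cong (c *ℚ D *ℚ_) (trans eq (cong (_*ℚ A) (trans (cong ℕ→ℚ (ℕP.^-distribˡ-+-* p M r))
           (ℕ→ℚ-homo-* (p ^ M) (p ^ r))))) ⟩
        c *ℚ D *ℚ (Pᴹ *ℚ Pʳ *ℚ A)
      ≡⟨ solve 5 (λ c d q r a → c :* d :* (q :* r :* a) := c :* (r :* d) :* (q :* a)) refl c D Pᴹ Pʳ A ⟩
        c *ℚ (Pʳ *ℚ D) *ℚ (Pᴹ *ℚ A)
      ≡⟨ cong (_*ℚ (Pᴹ *ℚ A)) c*p^r*d≡↥c ⟩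
        ℤ→ℚ (↥ c) *ℚ (Pᴹ *ℚ A)
      ≡⟨ solve 3 (λ n q a → n :* (q :* a) := q :* (n :* a)) refl (ℤ→ℚ (↥ c)) Pᴹ A ⟩
        Pᴹ *ℚ (ℤ→ℚ (↥ c) *ℚ A)
      ≡⟨ cong (Pᴹ *ℚ_) (ℤ→ℚ-homo-* (↥ c) a) ⟨
        Pᴹ *ℚ ℤ→ℚ (↥ c ℤ.* a)
      ∎)
      where
      Pᴹ = ℕ→ℚ (p ^ M)
      Pʳ = ℕ→ℚ (p ^ r)
      D = ℕ→ℚ d
      A = ℤ→ℚ a
      c*p^r*d≡↥c : c *ℚ (Pʳ *ℚ D) ≡ ℤ→ℚ (↥ c)
      c*p^r*d≡↥c = trans (cong (c *ℚ_) (trans (sym (ℕ→ℚ-homo-* (p ^ r) d)) (cong ℕ→ℚ (sym ↧c≡p^r*d))))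
        (q*↧q≡↥q c)

  -- A record, so that the sequence and the limit can be inferred from a convergence proof.
  infix 4 _⟶_
  record _⟶_ (a : ℕ → ℚ) (L : ℚ) : Set where
    constructor converges
    field convergesPAdic : ConvergesPAdic p a L

  ⟶-cong : ∀ {a b L K} → (∀ N → a N ≡ b N) → L ≡ K → a ⟶ L → b ⟶ K
  ⟶-cong {L = L} a≗b refl (converges a⟶L) = converges λ M →
    map₂ (λ close N N₀≤N → subst (λ z → InPPow p M (z -ℚ L)) (a≗b N) (close N N₀≤N)) (a⟶L M)

  ⟶-const : ∀ c → (λ _ → c) ⟶ c
  ⟶-const c = converges λ M → 0 , λ _ _ → subst (InPPow p M) (sym (ℚP.+-inverseʳ c)) (InPPow-0 M)

  ⟶-+ : ∀ {a b L K} → a ⟶ L → b ⟶ K → (λ N → a N +ℚ b N) ⟶ L +ℚ K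
  ⟶-+ {a} {b} {L} {K} (converges a⟶L) (converges b⟶K) = converges close
    where
    close : ConvergesPAdic p (λ N → a N +ℚ b N) (L +ℚ K)
    close M with a⟶L M | b⟶K M
    ... | N₁ , close₁ | N₂ , close₂ = N₁ ⊔ N₂ , λ N N₁⊔N₂≤N →
      subst (InPPow p M)
        (solve 4 (λ a b l k → (a :- l) :+ (b :- k) := (a :+ b) :- (l :+ k)) refl (a N) (b N) L K)
        (InPPow-+ {M} {a N -ℚ L} {b N -ℚ K} (close₁ N (ℕP.≤-trans (ℕP.m≤m⊔n N₁ N₂) N₁⊔N₂≤N))
                                            (close₂ N (ℕP.≤-trans (ℕP.m≤n⊔m N₁ N₂) N₁⊔N₂≤N)))

  ⟶-neg : ∀ {a L} → a ⟶ L → (λ N → -ℚ a N) ⟶ -ℚ L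
  ⟶-neg {a} {L} (converges a⟶L) = converges λ M → map₂ (λ close N N₀≤N →
    subst (InPPow p M) (solve 2 (λ a l → :- (a :- l) := (:- a) :- (:- l)) refl (a N) L)
      (InPPow-neg {M} {a N -ℚ L} (close N N₀≤N))) (a⟶L M)

  ⟶-*ˡ : ∀ c {a L} → a ⟶ L → (λ N → c *ℚ a N) ⟶ c *ℚ L
  ⟶-*ˡ c {a} {L} (converges a⟶L) = converges λ M → let r , scale = InPPow-*ˡ c in map₂ (λ close N N₀≤N →
    subst (InPPow p M) (solve 3 (λ c a l → c :* (a :- l) := c :* a :- c :* l) refl c (a N) L)
      (scale M {a N -ℚ L} (close N N₀≤N))) (a⟶L (M + r))

  ⟶-sumBelow : ∀ n {a : ℕ → ℕ → ℚ} {L : ℕ → ℚ} → (∀ l → l < n → a l ⟶ L l) →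
    (λ N → sumBelow n (λ l → a l N)) ⟶ sumBelow n L
  ⟶-sumBelow zero    a⟶L = ⟶-const 0ℚ
  ⟶-sumBelow (suc n) a⟶L =
    ⟶-+ (⟶-sumBelow n (λ l l<n → a⟶L l (ℕP.m<n⇒m<1+n l<n))) (a⟶L n (ℕP.n<1+n n))

  [p^N]^m⟶δ₀ : ∀ m → (λ N → ℕ→ℚ (p ^ N) ^ℚ m) ⟶ δ₀ m
  [p^N]^m⟶δ₀ zero    = ⟶-const 1ℚ
  [p^N]^m⟶δ₀ (suc m) = converges λ M → M , λ N M≤N →
    subst (InPPow p M) (trans (ℕ→ℚ-homo-^ (p ^ N) (suc m)) (sym (ℚP.+-identityʳ _)))
      (∣⇒InPPow {M} (∣-trans (m^n∣m^o p M≤N) (m∣m*n ((p ^ N) ^ m))))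

  ⟶-binomialSum⁻¹ : ∀ {a : ℕ → ℕ → ℚ} {b : ℕ → ℚ} →
    (∀ m → (λ N → binomialSum (λ j → a j N) m) ⟶ binomialSum b m) → ∀ m → a m ⟶ b m
  ⟶-binomialSum⁻¹ {a} {b} binomialSum⟶ = <-rec (λ m → a m ⟶ b m) step
    where
    step : ∀ m → (∀ {j} → j < m → a j ⟶ b j) → a m ⟶ b m
    step m below = ⟶-cong (λ N → sym (binomialSum-top (λ j → a j N) m)) (sym (binomialSum-top b m))
      (⟶-*ˡ ((+ 1) / suc m) (⟶-+ (binomialSum⟶ m)
        (⟶-neg (⟶-sumBelow m (λ j j<m → ⟶-*ˡ (ℕ→ℚ (suc m C j)) (below j<m))))))

  private
    weight : ℕ → ℚ
    weight N = ((+ 1) / p ^ N) {{ℕP.m^n≢0 p N}}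

  volkenborn-cong : ∀ {f g L} → (∀ x → f x ≡ g x) → riemannSum p pp f ⟶ L → riemannSum p pp g ⟶ L
  volkenborn-cong f≗g = ⟶-cong (λ N → cong (weight N *ℚ_) (sumBelow-cong (p ^ N) (λ x → f≗g (ℕ→ℚ x)))) refl

  volkenborn-*ˡ : ∀ c f {L} → riemannSum p pp f ⟶ L → riemannSum p pp (λ x → c *ℚ f x) ⟶ c *ℚ L
  volkenborn-*ˡ c f = ⟶-cong (λ N → begin
      c *ℚ (weight N *ℚ sumBelow (p ^ N) (λ x → f (ℕ→ℚ x)))
    ≡⟨ solve 3 (λ c w s → c :* (w :* s) := w :* (c :* s)) refl
         c (weight N) (sumBelow (p ^ N) (λ x → f (ℕ→ℚ x))) ⟩
      weight N *ℚ (c *ℚ sumBelow (p ^ N) (λ x → f (ℕ→ℚ x)))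
    ≡⟨ cong (weight N *ℚ_) (*-distribˡ-sumBelow (p ^ N) c (λ x → f (ℕ→ℚ x))) ⟩
      weight N *ℚ sumBelow (p ^ N) (λ x → c *ℚ f (ℕ→ℚ x))
    ∎) refl ∘ ⟶-*ˡ c

  volkenborn-sumBelow : ∀ K (g : ℕ → ℚ → ℚ) {L : ℕ → ℚ} → (∀ l → l < K → riemannSum p pp (g l) ⟶ L l) →
    riemannSum p pp (λ x → sumBelow K (λ l → g l x)) ⟶ sumBelow K L
  volkenborn-sumBelow K g = ⟶-cong (λ N → begin
      sumBelow K (λ l → weight N *ℚ sumBelow (p ^ N) (λ x → g l (ℕ→ℚ x)))
    ≡⟨ *-distribˡ-sumBelow K (weight N) (λ l → sumBelow (p ^ N) (λ x → g l (ℕ→ℚ x))) ⟨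
      weight N *ℚ sumBelow K (λ l → sumBelow (p ^ N) (λ x → g l (ℕ→ℚ x)))
    ≡⟨ cong (weight N *ℚ_) (sumBelow-comm K (p ^ N) (λ l x → g l (ℕ→ℚ x))) ⟩
      weight N *ℚ sumBelow (p ^ N) (λ x → sumBelow K (λ l → g l (ℕ→ℚ x)))
    ∎) refl ∘ ⟶-sumBelow K

  volkenborn-^ : ∀ m → riemannSum p pp (_^ℚ m) ⟶ bernoulli m
  volkenborn-^ = ⟶-binomialSum⁻¹ (λ m → ⟶-cong
    (λ N → sym (binomialSum-meanPowerSum (p ^ N) {{ℕP.m^n≢0 p N}} m))
    (sym (binomialSum-bernoulli m))
    ([p^N]^m⟶δ₀ m))

[m+n]∸[o+q]≡[m∸o]+[n∸q] : ∀ {m n o q} → o ≤ m → q ≤ n → (m + n) ∸ (o + q) ≡ (m ∸ o) + (n ∸ q)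
[m+n]∸[o+q]≡[m∸o]+[n∸q] {m} {n} {o} {q} o≤m q≤n = begin
  (m + n) ∸ (o + q)     ≡⟨ ℕP.∸-+-assoc (m + n) o q ⟨
  (m + n) ∸ o ∸ q       ≡⟨ cong (_∸ q) (ℕP.+-∸-comm n o≤m) ⟩
  (m ∸ o) + n ∸ q       ≡⟨ ℕP.+-∸-assoc (m ∸ o) q≤n ⟩
  (m ∸ o) + (n ∸ q)     ∎

s*k≤sumFinℕ : ∀ s k (ns : Fin s → ℕ) → (∀ i → k ≤ ns i) → s * k ≤ sumFinℕ ns
s*k≤sumFinℕ zero    k ns k≤ns = z≤n
s*k≤sumFinℕ (suc s) k ns k≤ns =
  ℕP.+-mono-≤ (k≤ns Fin.zero) (s*k≤sumFinℕ s k (λ i → ns (Fin.suc i)) (λ i → k≤ns (Fin.suc i)))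

prodFin-bernstein : ∀ s k (ns : Fin s → ℕ) → (∀ i → k ≤ ns i) → ∀ x →
  prodFin (λ i → bernstein k (ns i) x) ≡
  prodFin (λ i → ℕ→ℚ (ns i C k)) *ℚ (x ^ℚ (s * k) *ℚ (1ℚ -ℚ x) ^ℚ (sumFinℕ ns ∸ s * k))
prodFin-bernstein zero    k ns k≤ns x = refl
prodFin-bernstein (suc s) k ns k≤ns x = begin
    bernstein k n₀ x *ℚ prodFin (λ i → bernstein k (ns′ i) x)
  ≡⟨ cong (bernstein k n₀ x *ℚ_) (prodFin-bernstein s k ns′ k≤ns′ x) ⟩
    (c₀ *ℚ x ^ℚ k *ℚ y ^ℚ (n₀ ∸ k)) *ℚ (c′ *ℚ (x ^ℚ (s * k) *ℚ y ^ℚ (sumFinℕ ns′ ∸ s * k)))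
  ≡⟨ solve 6 (λ a b c d e f → (a :* b :* c) :* (d :* (e :* f)) := (a :* d) :* ((b :* e) :* (c :* f))) refl
       c₀ (x ^ℚ k) (y ^ℚ (n₀ ∸ k)) c′ (x ^ℚ (s * k)) (y ^ℚ (sumFinℕ ns′ ∸ s * k)) ⟩
    (c₀ *ℚ c′) *ℚ ((x ^ℚ k *ℚ x ^ℚ (s * k)) *ℚ (y ^ℚ (n₀ ∸ k) *ℚ y ^ℚ (sumFinℕ ns′ ∸ s * k)))
  ≡⟨ cong₂ (λ u v → (c₀ *ℚ c′) *ℚ (u *ℚ v)) (sym (^ℚ-distribˡ-+-* x k (s * k)))
       (sym (^ℚ-distribˡ-+-* y (n₀ ∸ k) (sumFinℕ ns′ ∸ s * k))) ⟩
    (c₀ *ℚ c′) *ℚ (x ^ℚ (k + s * k) *ℚ y ^ℚ ((n₀ ∸ k) + (sumFinℕ ns′ ∸ s * k)))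
  ≡⟨ cong (λ e → (c₀ *ℚ c′) *ℚ (x ^ℚ (k + s * k) *ℚ y ^ℚ e))
       ([m+n]∸[o+q]≡[m∸o]+[n∸q] (k≤ns Fin.zero) (s*k≤sumFinℕ s k ns′ k≤ns′)) ⟨
    (c₀ *ℚ c′) *ℚ (x ^ℚ (k + s * k) *ℚ y ^ℚ ((n₀ + sumFinℕ ns′) ∸ (k + s * k)))
  ∎
  where
  n₀ = ns Fin.zero
  ns′ : Fin s → ℕ
  ns′ i = ns (Fin.suc i)
  k≤ns′ : ∀ i → k ≤ ns′ i
  k≤ns′ i = k≤ns (Fin.suc i)
  y = 1ℚ -ℚ x
  c₀ = ℕ→ℚ (n₀ C k)
  c′ = prodFin (λ i → ℕ→ℚ (ns′ i C k))

x^a*[1-x]^n≡sumBelow : ∀ x a n →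
  x ^ℚ a *ℚ (1ℚ -ℚ x) ^ℚ n ≡ sumBelow (suc n) (λ l → ℕ→ℚ (n C l) *ℚ (-ℚ 1ℚ) ^ℚ l *ℚ x ^ℚ (a + l))
x^a*[1-x]^n≡sumBelow x a n = begin
    x ^ℚ a *ℚ (1ℚ -ℚ x) ^ℚ n
  ≡⟨ cong (x ^ℚ a *ℚ_) (binomial-theorem n (-ℚ x)) ⟩
    x ^ℚ a *ℚ sumBelow (suc n) (λ l → ℕ→ℚ (n C l) *ℚ (-ℚ x) ^ℚ l)
  ≡⟨ *-distribˡ-sumBelow (suc n) (x ^ℚ a) (λ l → ℕ→ℚ (n C l) *ℚ (-ℚ x) ^ℚ l) ⟩
    sumBelow (suc n) (λ l → x ^ℚ a *ℚ (ℕ→ℚ (n C l) *ℚ (-ℚ x) ^ℚ l))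
  ≡⟨ sumBelow-cong (suc n) term ⟩
    sumBelow (suc n) (λ l → ℕ→ℚ (n C l) *ℚ (-ℚ 1ℚ) ^ℚ l *ℚ x ^ℚ (a + l))
  ∎
  where
  term : ∀ l → x ^ℚ a *ℚ (ℕ→ℚ (n C l) *ℚ (-ℚ x) ^ℚ l) ≡ ℕ→ℚ (n C l) *ℚ (-ℚ 1ℚ) ^ℚ l *ℚ x ^ℚ (a + l)
  term l = begin
      x ^ℚ a *ℚ (ℕ→ℚ (n C l) *ℚ (-ℚ x) ^ℚ l)
    ≡⟨ cong (λ z → x ^ℚ a *ℚ (ℕ→ℚ (n C l) *ℚ z ^ℚ l)) (solve 1 (λ x → :- x := (:- con 1ℚ) :* x) refl x) ⟩
      x ^ℚ a *ℚ (ℕ→ℚ (n C l) *ℚ ((-ℚ 1ℚ) *ℚ x) ^ℚ l)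
    ≡⟨ cong (λ z → x ^ℚ a *ℚ (ℕ→ℚ (n C l) *ℚ z)) (^ℚ-distribʳ-* (-ℚ 1ℚ) x l) ⟩
      x ^ℚ a *ℚ (ℕ→ℚ (n C l) *ℚ ((-ℚ 1ℚ) ^ℚ l *ℚ x ^ℚ l))
    ≡⟨ solve 4 (λ u c s v → u :* (c :* (s :* v)) := c :* s :* (u :* v)) refl
         (x ^ℚ a) (ℕ→ℚ (n C l)) ((-ℚ 1ℚ) ^ℚ l) (x ^ℚ l) ⟩
      ℕ→ℚ (n C l) *ℚ (-ℚ 1ℚ) ^ℚ l *ℚ (x ^ℚ a *ℚ x ^ℚ l)
    ≡⟨ cong (ℕ→ℚ (n C l) *ℚ (-ℚ 1ℚ) ^ℚ l *ℚ_) (^ℚ-distribˡ-+-* x a l) ⟨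
      ℕ→ℚ (n C l) *ℚ (-ℚ 1ℚ) ^ℚ l *ℚ x ^ℚ (a + l)
    ∎

mainTheorem4 : (p : ℕ) (pp : Prime p) (s k : ℕ) (ns : Fin s → ℕ) →
  (∀ i → k ≤ ns i) →
  VolkenbornIntegral≡ p pp (λ x → prodFin (λ i → bernstein k (ns i) x))
    (prodFin (λ i → ℕ→ℚ (ns i C k)) *ℚ
      sumBelow (1 + (sumFinℕ ns ∸ s * k))
        (λ l → ℕ→ℚ ((sumFinℕ ns ∸ s * k) C l) *ℚ ((-ℚ 1ℚ) ^ℚ l) *ℚ bernoulli (s * k + l)))
mainTheorem4 p pp s k ns k≤ns = _⟶_.convergesPAdic
  (volkenborn-cong p pp expansion
    (volkenborn-*ˡ p pp c (λ x → sumBelow (suc M) (λ l → monomial l x))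
      (volkenborn-sumBelow p pp (suc M) monomial λ l _ →
        volkenborn-*ˡ p pp (a l) (_^ℚ (s * k + l)) (volkenborn-^ p pp (s * k + l)))))
  where
  M = sumFinℕ ns ∸ s * k
  c = prodFin (λ i → ℕ→ℚ (ns i C k))
  a : ℕ → ℚ
  a l = ℕ→ℚ (M C l) *ℚ (-ℚ 1ℚ) ^ℚ l
  monomial : ℕ → ℚ → ℚ
  monomial l x = a l *ℚ x ^ℚ (s * k + l)
  expansion : ∀ x → c *ℚ sumBelow (suc M) (λ l → monomial l x) ≡ prodFin (λ i → bernstein k (ns i) x)
  expansion x = sym (trans (prodFin-bernstein s k ns k≤ns x)
    (cong (c *ℚ_) (x^a*[1-x]^n≡sumBelow x (s * k) M)))
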